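{- Let $A=(Ctrl,Sto,\mathit{init},\mathit{fin},\to)$ and $A'=(Ctrl',Sto',\mathit{init}',\mathit{fin}',\to')$ be automata and $\mathcal{Q},\mathcal{S}\subseteq Sto\times Sto'$. Then $A,A'\models\langle\mathcal{Q}\leadsto\mathcal{S}\rangle$ if and only if there exist live alignment conditions $L,R,J$ and a keep set $K$ such that the filtered alignment automaton $\prod(A,A',L,R,J,K)$ is $\mathcal{Q}$-adequate in the $\forall\exists$ sense and $\prod(A,A',L,R,J,K)\models\{\mathcal{Q}\}\{\mathcal{S}\}$.
   Context: An automaton is $(Ctrl,Sto,\mathit{init},\mathit{fin},\to)$ with $Sto$ a set, $Ctrl$ a finite set containing distinct $\mathit{init},\mathit{fin}$, and $\to\ \subseteq(Ctrl\times Sto)^2$ such that $(n,s)\to(m,t)$ implies $n\neq\mathit{fin}$ and $n\neq m$. $A,A'\models\langle\mathcal{Q}\leadsto\mathcal{S}\rangle$ means: for all $(s,s')\in\mathcal{Q}$ and $t$ with $(\mathit{init},s)\to^*(\mathit{fin},t)$ there is $t'$ with $(\mathit{init}',s')\to'^*(\mathit{fin}',t')$ and $(t,t')\in\mathcal{S}$. For an automaton $B$ with stores $Sto_B$, $B\models\{P\}\{Q\}$ means for all $s,t$ with $(\mathit{init}_B,s)\to_B^*(\mathit{fin}_B,t)$, $s\in P$ implies $t\in Q$. Sets $L,R,J\subseteq(Ctrl\times Ctrl')\times(Sto\times Sto')$ are live if states in $L$ have a $\to$-successor on the left, in $R$ a $\to'$-successor on the right, in $J$ both. The (unfiltered) product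 transition $((n,n'),(s,s'))\Rightarrow((m,m'),(t,t'))$ holds iff (LO) source in $L$, $(n,s)\to(m,t)$, $(n',s')=(m',t')$; or (RO) source in $R$, $(n,s)=(m,t)$, $(n',s')\to'(m',t')$; or (JO) source in $J$, $(n,s)\to(m,t)$, $(n',s')\to'(m',t')$. For a keep set $K\subseteq(Ctrl\times Ctrl')\times(Sto\times Sto')$, the filtered alignment automaton $\prod(A,A',L,R,J,K)$ is $(Ctrl\times Ctrl',Sto\times Sto',(\mathit{init},\mathit{init}'),(\mathit{fin},\mathit{fin}'),\Rightarrow_K)$ where $X\Rightarrow_K Y$ iff $X\Rightarrow Y$ and $Y\in K$. It is $\mathcal{Q}$-adequate in the $\forall\exists$ sense if for all $(s,s')\in\mathcal{Q}$ and $t$ with $(\mathit{init},s)\to^*(\mathit{fin},t)$ there exists $t'$ with $((\mathit{init},\mathit{init}'),(s,s'))\Rightarrow_K^*((\mathit{fin},\mathit{fin}'),(t,t'))$. -}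

module Defs where

open import Data.Nat using (ℕ)
open import Data.Fin using (Fin)
open import Data.Product using (Σ; ∃; _×_; _,_)
open import Data.Empty using (⊥)
open import Relation.Nullary using (¬_)
open import Relation.Binary.PropositionalEquality using (_≡_)
open import Relation.Binary.Construct.Closure.ReflexiveTransitive using (Star)
open import Function.Bundles using (_↔_)

record Automaton : Set₁ where
  field
    Ctrl     : Set
    Sto      : Set
    init     : Ctrl
    fin      : Ctrl
    step     : Ctrl × Sto → Ctrl × Sto → Set
    ctrlFinite : Σ ℕ (λ k → Ctrl ↔ Fin k)
    init≢fin : ¬ (init ≡ fin)
    step-notFin : ∀ {n s m t} → step (n , s) (m , t) → ¬ (n ≡ fin)
    step-moves  : ∀ {n s m t} → step (n , s) (m , t) → ¬ (n ≡ m)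

open Automaton public

Steps : (A : Automaton) → Ctrl A × Sto A → Ctrl A × Sto A → Set
Steps A = Star (step A)

RelSpec : (A A' : Automaton) → (Sto A → Sto A' → Set) → (Sto A → Sto A' → Set) → Set
RelSpec A A' Q S =
  ∀ s s' t → Q s s' → Steps A (init A , s) (fin A , t) →
  ∃ λ t' → Steps A' (init A' , s') (fin A' , t') × S t t'

HoareSpec : (B : Automaton) → (Sto B → Set) → (Sto B → Set) → Set
HoareSpec B P Q =
  ∀ s t → Steps B (init B , s) (fin B , t) → P s → Q t

PState : (A A' : Automaton) → Set
PState A A' = (Ctrl A × Ctrl A') × (Sto A × Sto A')

PSet : (A A' : Automaton) → Set₁
PSet A A' = PState A A' → Set

Live : (A A' : Automaton) → PSet A A' → PSet A A' → PSet A A' → Set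
Live A A' L R J =
  (∀ n n' s s' → L ((n , n') , (s , s')) → ∃ λ mt → step A (n , s) mt)
  × (∀ n n' s s' → R ((n , n') , (s , s')) → ∃ λ mt' → step A' (n' , s') mt')
  × (∀ n n' s s' → J ((n , n') , (s , s')) →
       (∃ λ mt → step A (n , s) mt) × (∃ λ mt' → step A' (n' , s') mt'))

data ProdStep (A A' : Automaton) (L R J : PSet A A') : PState A A' → PState A A' → Set where
  lo : ∀ {n n' s s' m t} → L ((n , n') , (s , s')) → step A (n , s) (m , t) →
       ProdStep A A' L R J ((n , n') , (s , s')) ((m , n') , (t , s'))
  ro : ∀ {n n' s s' m' t'} → R ((n , n') , (s , s')) → step A' (n' , s') (m' , t') →
       ProdStep A A' L R J ((n , n') , (s , s')) ((n , m') , (s , t'))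
  jo : ∀ {n n' s s' m m' t t'} → J ((n , n') , (s , s')) →
       step A (n , s) (m , t) → step A' (n' , s') (m' , t') →
       ProdStep A A' L R J ((n , n') , (s , s')) ((m , m') , (t , t'))

FiltStep : (A A' : Automaton) (L R J K : PSet A A') → PState A A' → PState A A' → Set
FiltStep A A' L R J K X Y = ProdStep A A' L R J X Y × K Y

Adequate : (A A' : Automaton) (L R J K : PSet A A') → (Sto A → Sto A' → Set) → Set
Adequate A A' L R J K Q =
  ∀ s s' t → Q s s' → Steps A (init A , s) (fin A , t) →
  ∃ λ t' → Star (FiltStep A A' L R J K)
              ((init A , init A') , (s , s')) ((fin A , fin A') , (t , t'))

-- The product ∏(A,A',L,R,J,K) ⊨ {Q}{S}, spelled out on the product automaton
-- (Ctrl×Ctrl', Sto×Sto', (init,init'), (fin,fin'), ⇒_K).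
ProdHoare : (A A' : Automaton) (L R J K : PSet A A') →
            (Sto A → Sto A' → Set) → (Sto A → Sto A' → Set) → Set
ProdHoare A A' L R J K Q S =
  ∀ s s' t t' →
  Star (FiltStep A A' L R J K) ((init A , init A') , (s , s')) ((fin A , fin A') , (t , t')) →
  Q s s' → S t t'

-- (⇐) The right component of a filtered product run is a run of A', and the
-- Hoare triple on the product supplies S on the final stores.
-- (⇒) Use the sequential alignment: A runs to completion while A' waits at init',
-- then A' runs to fin'.  The keep set only demands S at (fin , fin'), so the
-- Hoare triple holds by the last step of any run; A' cannot step from fin', so
-- reaching fin' on the right already fixes the final store.
module Submission where

open import Defs
open import Data.Product using (∃; _×_; _,_; proj₁; proj₂)
open import Data.Sum using (_⊎_; inj₁; inj₂)
open import Data.Empty using (⊥; ⊥-elim)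
open import Relation.Binary.PropositionalEquality using (_≡_; refl; cong; subst; sym)
open import Relation.Binary.Construct.Closure.ReflexiveTransitive using (Star; ε; _◅_; _◅◅_)

Steps-from-fin : (A : Automaton) {u : Sto A} {m : Ctrl A} {t : Sto A} →
                 Steps A (fin A , u) (m , t) → u ≡ t
Steps-from-fin A ε = refl
Steps-from-fin A (x ◅ _) = ⊥-elim (step-notFin A x refl)

module _ (A A' : Automaton) where

  right : PState A A' → Ctrl A' × Sto A'
  right ((_ , n') , (_ , s')) = n' , s'

  ProdStep-right : ∀ {L R J X Y} → ProdStep A A' L R J X Y →
                   right X ≡ right Y ⊎ step A' (right X) (right Y)
  ProdStep-right (lo _ _) = inj₁ refl
  ProdStep-right (ro _ x') = inj₂ x'
  ProdStep-right (jo _ _ x') = inj₂ x'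

  FiltSteps-right : ∀ {L R J K X Y} → Star (FiltStep A A' L R J K) X Y →
                    Steps A' (right X) (right Y)
  FiltSteps-right ε = ε
  FiltSteps-right ((p , _) ◅ xs) with ProdStep-right p
  ... | inj₁ refl = FiltSteps-right xs
  ... | inj₂ x' = x' ◅ FiltSteps-right xs

  FiltSteps-kept : ∀ {L R J K X Y} → K X → Star (FiltStep A A' L R J K) X Y → K Y
  FiltSteps-kept k ε = k
  FiltSteps-kept _ ((_ , k) ◅ xs) = FiltSteps-kept k xs

  seqL : PSet A A'
  seqL ((n , n') , (s , _)) = n' ≡ init A' × ∃ (step A (n , s))

  seqR : PSet A A'
  seqR ((n , n') , (_ , s')) = n ≡ fin A × ∃ (step A' (n' , s'))

  seqJ : PSet A A'
  seqJ _ = ⊥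

  finalIn : (Sto A → Sto A' → Set) → PSet A A'
  finalIn S ((n , n') , (t , t')) = (n , n') ≡ (fin A , fin A') → S t t'

  seq-live : Live A A' seqL seqR seqJ
  seq-live = (λ _ _ _ _ → proj₂) , (λ _ _ _ _ → proj₂) , (λ _ _ _ _ ())

  module _ (S : Sto A → Sto A' → Set) where

    SeqSteps : PState A A' → PState A A' → Set
    SeqSteps = Star (FiltStep A A' seqL seqR seqJ (finalIn S))

    lift-left : ∀ s' {n u m v} → Steps A (n , u) (m , v) →
                SeqSteps ((n , init A') , (u , s')) ((m , init A') , (v , s'))
    lift-left s' ε = ε
    lift-left s' (x ◅ xs) =
      (lo (refl , (_ , x)) x , λ e → ⊥-elim (init≢fin A' (cong proj₂ e))) ◅ lift-left s' xs

    lift-right : ∀ {t n' u' t'} → S t t' → Steps A' (n' , u') (fin A' , t') →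
                 SeqSteps ((fin A , n') , (t , u')) ((fin A , fin A') , (t , t'))
    lift-right st ε = ε
    lift-right {t} st (x' ◅ xs) =
      (ro (refl , (_ , x')) x' , kept) ◅ lift-right st xs
      where
      kept : finalIn S ((fin A , _) , (t , _))
      kept refl = subst (S t) (sym (Steps-from-fin A' xs)) st

    seq-adequate : ∀ {Q} → RelSpec A A' Q S → Adequate A A' seqL seqR seqJ (finalIn S) Q
    seq-adequate spec s s' t q run with spec s s' t q run
    ... | t' , run' , st = t' , lift-left s' run ◅◅ lift-right st run'

    seq-hoare : ∀ {Q} → ProdHoare A A' seqL seqR seqJ (finalIn S) Q S
    seq-hoare _ _ _ _ run _ = FiltSteps-kept initial-kept run refl
      where
      initial-kept : ∀ {s s'} → finalIn S ((init A , init A') , (s , s'))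
      initial-kept e = ⊥-elim (init≢fin A (cong proj₁ e))

lemma7p4 : (A A' : Automaton) (Q S : Sto A → Sto A' → Set) →
    (RelSpec A A' Q S →
       ∃ λ (L : PSet A A') → ∃ λ (R : PSet A A') → ∃ λ (J : PSet A A') → ∃ λ (K : PSet A A') →
         Live A A' L R J × Adequate A A' L R J K Q × ProdHoare A A' L R J K Q S)
    × ((∃ λ (L : PSet A A') → ∃ λ (R : PSet A A') → ∃ λ (J : PSet A A') → ∃ λ (K : PSet A A') →
         Live A A' L R J × Adequate A A' L R J K Q × ProdHoare A A' L R J K Q S)
       → RelSpec A A' Q S)
lemma7p4 A A' Q S = aligned , sound
  where
  aligned : RelSpec A A' Q S → _
  aligned spec = seqL A A' , seqR A A' , seqJ A A' , finalIn A A' S ,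
                 seq-live A A' , seq-adequate A A' S spec , seq-hoare A A' S

  sound : _ → RelSpec A A' Q S
  sound (_ , _ , _ , _ , _ , adequate , hoare) s s' t q run with adequate s s' t q run
  ... | t' , prun = t' , FiltSteps-right A A' prun , hoare s s' t t' prun q
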